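{- Let $\mathcal{T}_0=\{T^\flat,T^\dagger,T^\ddagger,T^\sharp\}$ and $\mathcal{T}_{k+1}=\{S\otimes T: S,T\in\mathcal{T}_k\}$ for $k\geqslant0$. Let $k\geqslant 0$ and let $d$ be an integer with $3\cdot2^k+k+1\leqslant d\leqslant 6\cdot 2^k+k+1$. Then all triples $T\in\mathcal{T}_k$ with $\delta(T)=d$ are mutually congruent.
   Context: Let $S=\{0,1,*\}$; elements of $S^d$ are strings of length $d$. For $u,v\in S^d$ let $\mathrm{dist}(u,v)$ be the number of positions $i$ with $u_i\neq v_i$ and $u_i,v_i\in\{0,1\}$. A list is a finite sequence of strings all of the same length (repetitions allowed); $|L|$ is its number of entries; $[x]$ is the one-entry list of the string $x$; $*^m$ is the string of $m$ jokers $*$. Operations: pairing $[v_1,\dots,v_n]\ominus[w_1,\dots,w_n]=[v_1w_1,\dots,v_nw_n]$; concatenation $AB=[v_iw_j]$ (all pairs, ordered lexicographically in $(i,j)$); sum $A+B$ = entries of $A$ followed by entries of $B$; $1\cdot A=A$, $(k+1)\cdot A=k\cdot A+A$; concatenation before sum. For a triple of lists $T=(A,B,C)$: $\alpha(T)$, $\beta(T)$ are the lengths of the strings in $A$, $B$; $\delta(T)=\alpha(T)+\beta(T)$; $n(T)=|A|$; $g(T)=|C|$. Triples $T=(A,B,C)$, $T'=(A',B',C')$ are concordant if $\alpha(T)=\alpha(T')$ and $\mathrm{dist}(u,v)\leqslant1$ for all entries $u,v$ of $A+A'$; they are congruent if they are concordant and $\beta(T)=\beta(T')$, $n(T)=n(T')$,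 $g(T)=g(T')$. The compound of concordant triples is $T\otimes T'=(A'',B'',C'')$ with $A''=[0]A+[0]A'+[1]\big((g(T)g(T'))\cdot[*^{\alpha(T)}]\big)$, $B''=[0]B[*^{\beta(T')}]+[1][*^{\beta(T)}]B'+[*]CC'$, $C''=[0]C[*^{\beta(T')}]+[1][*^{\beta(T)}]C'$. Let $G=[0,1]$, $H=[00,01,1*]$, $L=[000,001,01*,1**]$. Define $T^\flat=(3\cdot[00]+3\cdot[01]+3\cdot[1*],\ 3\cdot H,\ H)$; $T^\dagger=(4\cdot[00]+4\cdot[01]+4\cdot[1*],\ 3\cdot L,\ L)$; $T^\ddagger=(2\cdot[00]+2\cdot[01]+3\cdot[00]+3\cdot[01]+6\cdot[1*],\ 2\cdot([0]G[**])+2\cdot([1][*]H)+[*]GH,\ [0]G[**]+[1][*]H)$; $T^\sharp=(2\cdot(3\cdot[00]+3\cdot[01])+9\cdot[1*],\ 2\cdot([0]H[**])+2\cdot([1][**]H)+[*]HH,\ [0]H[**]+[1][**]H)$. -}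

module Defs where

open import Data.Nat using (ℕ; zero; suc; _+_; _*_; _^_; _≤_)
open import Data.List using (List; []; _∷_; _++_; map; concatMap; length; replicate)
open import Data.List.Membership.Propositional using (_∈_)
open import Data.Product using (_×_)
open import Relation.Binary.PropositionalEquality using (_≡_)

data Sym : Set where
  s0 s1 ⋆ : Sym

Str : Set
Str = List Sym

Lst : Set
Lst = List Str

diff : Sym → Sym → ℕ
diff s0 s1 = 1
diff s1 s0 = 1
diff _  _  = 0

dist : Str → Str → ℕ
dist (a ∷ u) (b ∷ v) = diff a b + dist u v
dist _ _ = 0

stars : ℕ → Str
stars m = replicate m ⋆

_·_ : Lst → Lst → Lst
A · B = concatMap (λ v → map (v ++_) B) A
infixl 7 _·_

_⊕_ : Lst → Lst → Lst
A ⊕ B = A ++ B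
infixl 6 _⊕_

-- k · A  (1·A = A, (k+1)·A = k·A + A); 0·A is the empty list (never used)
_×ₗ_ : ℕ → Lst → Lst
zero ×ₗ A = []
suc k ×ₗ A = (k ×ₗ A) ⊕ A
infixl 7 _×ₗ_

[_] : Str → Lst
[ x ] = x ∷ []

record Triple : Set where
  constructor triple
  field
    A B C : Lst
open Triple public

-- length of the strings of a list (all entries have the same length;
-- we read it off the first entry)
strLen : Lst → ℕ
strLen [] = 0
strLen (x ∷ _) = length x

α β δ n g : Triple → ℕ
α T = strLen (A T)
β T = strLen (B T)
δ T = α T + β T
n T = length (A T)
g T = length (C T)

Concordant : Triple → Triple → Set
Concordant T T' =
  (α T ≡ α T') ×
  (∀ u v → u ∈ (A T ⊕ A T') → v ∈ (A T ⊕ A T') → dist u v ≤ 1)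

Congruent : Triple → Triple → Set
Congruent T T' = Concordant T T' × (β T ≡ β T') × (n T ≡ n T') × (g T ≡ g T')

-- compound T ⊗ T' (as a formula; it is only used for concordant triples)
_⊗_ : Triple → Triple → Triple
T ⊗ T' = triple A'' B'' C''
  where
  A'' = [ s0 ∷ [] ] · A T ⊕ [ s0 ∷ [] ] · A T'
        ⊕ [ s1 ∷ [] ] · ((g T * g T') ×ₗ [ stars (α T) ])
  B'' = [ s0 ∷ [] ] · B T · [ stars (β T') ]
        ⊕ [ s1 ∷ [] ] · [ stars (β T) ] · B T'
        ⊕ [ ⋆ ∷ [] ] · C T · C T'
  C'' = [ s0 ∷ [] ] · C T · [ stars (β T') ]
        ⊕ [ s1 ∷ [] ] · [ stars (β T) ] · C T'

G H L : Lst
G = (s0 ∷ []) ∷ (s1 ∷ []) ∷ []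
H = (s0 ∷ s0 ∷ []) ∷ (s0 ∷ s1 ∷ []) ∷ (s1 ∷ ⋆ ∷ []) ∷ []
L = (s0 ∷ s0 ∷ s0 ∷ []) ∷ (s0 ∷ s0 ∷ s1 ∷ []) ∷ (s0 ∷ s1 ∷ ⋆ ∷ [])
    ∷ (s1 ∷ ⋆ ∷ ⋆ ∷ []) ∷ []

l00 l01 l1⋆ l0 l1 l⋆ l⋆⋆ : Lst
l00 = [ s0 ∷ s0 ∷ [] ]
l01 = [ s0 ∷ s1 ∷ [] ]
l1⋆ = [ s1 ∷ ⋆ ∷ [] ]
l0 = [ s0 ∷ [] ]
l1 = [ s1 ∷ [] ]
l⋆ = [ ⋆ ∷ [] ]
l⋆⋆ = [ ⋆ ∷ ⋆ ∷ [] ]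

T♭ T† T‡ T♯ : Triple
T♭ = triple (3 ×ₗ l00 ⊕ 3 ×ₗ l01 ⊕ 3 ×ₗ l1⋆) (3 ×ₗ H) H
T† = triple (4 ×ₗ l00 ⊕ 4 ×ₗ l01 ⊕ 4 ×ₗ l1⋆) (3 ×ₗ L) L
T‡ = triple (2 ×ₗ l00 ⊕ 2 ×ₗ l01 ⊕ 3 ×ₗ l00 ⊕ 3 ×ₗ l01 ⊕ 6 ×ₗ l1⋆)
            (2 ×ₗ (l0 · G · l⋆⋆) ⊕ 2 ×ₗ (l1 · l⋆ · H) ⊕ l⋆ · G · H)
            (l0 · G · l⋆⋆ ⊕ l1 · l⋆ · H)
T♯ = triple (2 ×ₗ (3 ×ₗ l00 ⊕ 3 ×ₗ l01) ⊕ 9 ×ₗ l1⋆)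
            (2 ×ₗ (l0 · H · l⋆⋆) ⊕ 2 ×ₗ (l1 · l⋆⋆ · H) ⊕ l⋆ · H · H)
            (l0 · H · l⋆⋆ ⊕ l1 · l⋆⋆ · H)

-- membership in 𝒯_k ; 𝒯_{k+1} = { S ⊗ T : S, T ∈ 𝒯_k } (compound taken
-- only for concordant pairs, where it is defined)
data 𝒯 : ℕ → Triple → Set where
  base♭ : 𝒯 0 T♭
  base† : 𝒯 0 T†
  base‡ : 𝒯 0 T‡
  base♯ : 𝒯 0 T♯
  step  : ∀ {k S T} → 𝒯 k S → 𝒯 k T → Concordant S T → 𝒯 (suc k) (S ⊗ T)

{-# OPTIONS --safe #-}
-- Every T ∈ 𝒯ₖ satisfies α = k + 2, g = β + 1 and 2n + g = g² + 12·2ᵏ, and every entry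
-- of its list A is a staircase string 0ⁱ 1 *ʲ or 0ᵐ of length k + 2; any two staircase
-- strings of the same length are at distance ≤ 1.  These facts hold for the four base
-- triples and survive the compound, under which α, g, n become α + 1, g + g' and
-- n + n' + g g', so that 2n + g − g² doubles.  Hence two triples of 𝒯ₖ with the same δ
-- have the same β, so the same g, so the same n.
module Submission where

open import Defs
open import Data.Nat using (ℕ; _+_; _*_; _^_; _≤_)
open import Relation.Binary.PropositionalEquality using (_≡_)

open import Data.Nat using (suc; _<_; z≤n; z<s)
open import Data.Nat.Properties
  using (≤-reflexive; ≤-trans; +-comm; +-suc; +-identityʳ; *-identityʳ; *-assoc; +-cancelˡ-≡; +-cancelʳ-≡; *-cancelˡ-≡)
open import Data.Nat.Tactic.RingSolver using (solve-∀)
open import Data.List using ([]; _∷_; _++_; map; length)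
open import Data.List.Properties using (length-++; length-map; length-replicate)
open import Data.List.Relation.Unary.All as All using (All; []; _∷_)
open import Data.List.Relation.Unary.All.Properties using (++⁺; map⁺)
open import Data.Product using (_,_)
open import Relation.Binary.PropositionalEquality using (refl; sym; trans; cong; cong₂; subst; subst₂; module ≡-Reasoning)
open ≡-Reasoning

data Staircase : ℕ → Str → Set where
  []  : Staircase 0 []
  0∷_ : ∀ {m u} → Staircase m u → Staircase (suc m) (s0 ∷ u)
  1∷⋆ : ∀ {m} → Staircase (suc m) (s1 ∷ stars m)

dist-starsˡ : ∀ m u → dist (stars m) u ≡ 0
dist-starsˡ 0       u       = refl
dist-starsˡ (suc m) []      = refl
dist-starsˡ (suc m) (_ ∷ u) = dist-starsˡ m u

dist-starsʳ : ∀ u m → dist u (stars m) ≡ 0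
dist-starsʳ []       m       = refl
dist-starsʳ (_ ∷ _)  0       = refl
dist-starsʳ (s0 ∷ u) (suc m) = dist-starsʳ u m
dist-starsʳ (s1 ∷ u) (suc m) = dist-starsʳ u m
dist-starsʳ (⋆ ∷ u)  (suc m) = dist-starsʳ u m

staircase-dist≤1 : ∀ {m u v} → Staircase m u → Staircase m v → dist u v ≤ 1
staircase-dist≤1 []               []               = z≤n
staircase-dist≤1 (0∷ p)           (0∷ q)           = staircase-dist≤1 p q
staircase-dist≤1 (0∷_ {u = u} _)  (1∷⋆ {m})        = ≤-reflexive (cong suc (dist-starsʳ u m))
staircase-dist≤1 (1∷⋆ {m})        (0∷_ {u = v} _)  = ≤-reflexive (cong suc (dist-starsˡ m v))
staircase-dist≤1 (1∷⋆ {m})        1∷⋆              = ≤-trans (≤-reflexive (dist-starsˡ m (stars m))) z≤n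

length-[]· : ∀ x X → length ([ x ] · X) ≡ length X
length-[]· x X = trans (length-++ (map (x ++_) X)) (trans (+-identityʳ _) (length-map (x ++_) X))

length-·[] : ∀ X y → length (X · [ y ]) ≡ length X
length-·[] []      y = refl
length-·[] (x ∷ X) y = cong suc (length-·[] X y)

length-×ₗ : ∀ m X → length (m ×ₗ X) ≡ m * length X
length-×ₗ 0       X = refl
length-×ₗ (suc m) X = begin
  length (m ×ₗ X ++ X)          ≡⟨ length-++ (m ×ₗ X) ⟩
  length (m ×ₗ X) + length X    ≡⟨ cong (_+ length X) (length-×ₗ m X) ⟩
  m * length X + length X       ≡⟨ +-comm (m * length X) (length X) ⟩
  suc m * length X              ∎

All-×ₗ : ∀ {P : Str → Set} m {X} → All P X → All P (m ×ₗ X)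
All-×ₗ 0       p = []
All-×ₗ (suc m) p = ++⁺ (All-×ₗ m p) p

All-[]· : ∀ {P : Str → Set} x {X} → All (λ v → P (x ++ v)) X → All P ([ x ] · X)
All-[]· x p = ++⁺ (map⁺ p) []

α-⊗ : ∀ S T → 0 < α S → α (S ⊗ T) ≡ suc (α S)
α-⊗ (triple (_ ∷ _) _ _) T _ = refl

β-⊗ : ∀ S T → 0 < β S → β (S ⊗ T) ≡ suc (β S + β T)
β-⊗ (triple _ (b ∷ _) _) T _ = cong suc (trans (length-++ b) (cong (length b +_) (length-replicate (β T))))

g-⊗ : ∀ S T → g (S ⊗ T) ≡ g S + g T
g-⊗ S T = begin
  length (l0 · C S · [ stars (β T) ] ++ l1 · [ stars (β S) ] · C T)
    ≡⟨ length-++ (l0 · C S · [ stars (β T) ]) ⟩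
  length (l0 · C S · [ stars (β T) ]) + length (l1 · [ stars (β S) ] · C T)
    ≡⟨ cong₂ _+_ (trans (length-·[] (l0 · C S) _) (length-[]· _ (C S))) (length-[]· _ (C T)) ⟩
  g S + g T
    ∎

n-⊗ : ∀ S T → n (S ⊗ T) ≡ n S + n T + g S * g T
n-⊗ S T = begin
  length (l0 · A S ⊕ l0 · A T ⊕ l1 · (g S * g T ×ₗ [ stars (α S) ]))
    ≡⟨ length-++ (l0 · A S ⊕ l0 · A T) ⟩
  length (l0 · A S ⊕ l0 · A T) + length (l1 · (g S * g T ×ₗ [ stars (α S) ]))
    ≡⟨ cong₂ _+_ (length-++ (l0 · A S)) (length-[]· (s1 ∷ []) (g S * g T ×ₗ [ stars (α S) ])) ⟩
  length (l0 · A S) + length (l0 · A T) + length (g S * g T ×ₗ [ stars (α S) ])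
    ≡⟨ cong₂ _+_ (cong₂ _+_ (length-[]· _ (A S)) (length-[]· _ (A T))) (length-×ₗ (g S * g T) _) ⟩
  n S + n T + g S * g T * 1
    ≡⟨ cong (n S + n T +_) (*-identityʳ (g S * g T)) ⟩
  n S + n T + g S * g T
    ∎


Excess : ℕ → ℕ → ℕ → Set
Excess e a c = 2 * a + c ≡ c * c + e

Excess-⊗ : ∀ {a b c d e} → Excess e a c → Excess e b d → Excess (2 * e) (a + b + c * d) (c + d)
Excess-⊗ {a} {b} {c} {d} {e} p q = begin
  2 * (a + b + c * d) + (c + d)            ≡⟨ regroup a b c d ⟩
  (2 * a + c) + (2 * b + d) + 2 * (c * d)  ≡⟨ cong₂ (λ x y → x + y + 2 * (c * d)) p q ⟩
  (c * c + e) + (d * d + e) + 2 * (c * d)  ≡⟨ square-of-sum c d e ⟩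
  (c + d) * (c + d) + 2 * e                ∎
  where
  regroup : ∀ a b c d → 2 * (a + b + c * d) + (c + d) ≡ (2 * a + c) + (2 * b + d) + 2 * (c * d)
  regroup = solve-∀
  square-of-sum : ∀ c d e → (c * c + e) + (d * d + e) + 2 * (c * d) ≡ (c + d) * (c + d) + 2 * e
  square-of-sum = solve-∀

Excess-injective : ∀ {a b c e} → Excess e a c → Excess e b c → a ≡ b
Excess-injective {a} {b} {c} p q = *-cancelˡ-≡ a b 2 (+-cancelʳ-≡ c (2 * a) (2 * b) (trans p (sym q)))

record Invariant (k : ℕ) (T : Triple) : Set where
  field
    α≡2+k       : α T ≡ 2 + k
    0<β         : 0 < β T
    g≡1+β       : g T ≡ suc (β T)
    excess      : Excess (2 ^ k * 12) (n T) (g T)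
    A-staircase : All (Staircase (2 + k)) (A T)
open Invariant

⊗-invariant : ∀ {k S T} → Invariant k S → Invariant k T → Invariant (suc k) (S ⊗ T)
⊗-invariant {k} {S} {T} iS iT = record
  { α≡2+k       = trans (α-⊗ S T (subst (0 <_) (sym (α≡2+k iS)) z<s)) (cong suc (α≡2+k iS))
  ; 0<β         = subst (0 <_) (sym (β-⊗ S T (0<β iS))) z<s
  ; g≡1+β       = g≡1+β⊗
  ; excess      = excess⊗
  ; A-staircase = ++⁺ (++⁺ (All-[]· (s0 ∷ []) (All.map 0∷_ (A-staircase iS)))
                             (All-[]· (s0 ∷ []) (All.map 0∷_ (A-staircase iT))))
                       (All-[]· (s1 ∷ []) (All-×ₗ (g S * g T) (top ∷ [])))
  }
  where
  g≡1+β⊗ : g (S ⊗ T) ≡ suc (β (S ⊗ T))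
  g≡1+β⊗ = begin
    g (S ⊗ T)                  ≡⟨ g-⊗ S T ⟩
    g S + g T                  ≡⟨ cong₂ _+_ (g≡1+β iS) (g≡1+β iT) ⟩
    suc (β S) + suc (β T)      ≡⟨ cong suc (+-suc (β S) (β T)) ⟩
    suc (suc (β S + β T))      ≡⟨ cong suc (β-⊗ S T (0<β iS)) ⟨
    suc (β (S ⊗ T))            ∎

  excess⊗ : Excess (2 ^ suc k * 12) (n (S ⊗ T)) (g (S ⊗ T))
  excess⊗ = subst₂ (Excess (2 ^ suc k * 12)) (sym (n-⊗ S T)) (sym (g-⊗ S T))
              (subst (λ e → Excess e (n S + n T + g S * g T) (g S + g T)) (sym (*-assoc 2 (2 ^ k) 12))
                (Excess-⊗ {n S} {n T} {g S} {g T} (excess iS) (excess iT)))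

  top : Staircase (3 + k) (s1 ∷ stars (α S))
  top = subst (λ m → Staircase (3 + k) (s1 ∷ stars m)) (sym (α≡2+k iS)) 1∷⋆

copies : ∀ m {x} → Staircase 2 x → All (Staircase 2) (m ×ₗ [ x ])
copies m p = All-×ₗ m (p ∷ [])

00ˢ : Staircase 2 (s0 ∷ s0 ∷ [])
00ˢ = 0∷ 0∷ []

01ˢ : Staircase 2 (s0 ∷ s1 ∷ [])
01ˢ = 0∷ 1∷⋆

1⋆ˢ : Staircase 2 (s1 ∷ ⋆ ∷ [])
1⋆ˢ = 1∷⋆

invariant : ∀ {k T} → 𝒯 k T → Invariant k T
invariant base♭ = record
  { α≡2+k = refl ; 0<β = z<s ; g≡1+β = refl ; excess = refl
  ; A-staircase = ++⁺ (++⁺ (copies 3 00ˢ) (copies 3 01ˢ)) (copies 3 1⋆ˢ) }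
invariant base† = record
  { α≡2+k = refl ; 0<β = z<s ; g≡1+β = refl ; excess = refl
  ; A-staircase = ++⁺ (++⁺ (copies 4 00ˢ) (copies 4 01ˢ)) (copies 4 1⋆ˢ) }
invariant base‡ = record
  { α≡2+k = refl ; 0<β = z<s ; g≡1+β = refl ; excess = refl
  ; A-staircase = ++⁺ (++⁺ (++⁺ (++⁺ (copies 2 00ˢ) (copies 2 01ˢ)) (copies 3 00ˢ)) (copies 3 01ˢ))
                      (copies 6 1⋆ˢ) }
invariant base♯ = record
  { α≡2+k = refl ; 0<β = z<s ; g≡1+β = refl ; excess = refl
  ; A-staircase = ++⁺ (All-×ₗ 2 (++⁺ (copies 3 00ˢ) (copies 3 01ˢ))) (copies 9 1⋆ˢ) }
invariant (step S∈ T∈ _) = ⊗-invariant (invariant S∈) (invariant T∈)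

concordant : ∀ {k T T'} → Invariant k T → Invariant k T' → Concordant T T'
concordant {k} {T} {T'} i i' = trans (α≡2+k i) (sym (α≡2+k i')) , λ _ _ u∈ v∈ →
  staircase-dist≤1 (All.lookup staircases u∈) (All.lookup staircases v∈)
  where
  staircases : All (Staircase (2 + k)) (A T ⊕ A T')
  staircases = ++⁺ (A-staircase i) (A-staircase i')

congruent : ∀ {k T T'} → Invariant k T → Invariant k T' → δ T ≡ δ T' → Congruent T T'
congruent {k} {T} {T'} i i' δ≡ = concordant i i' , β≡ , n≡ , g≡
  where
  β≡ : β T ≡ β T'
  β≡ = +-cancelˡ-≡ (α T) (β T) (β T') (trans δ≡ (cong (_+ β T') (trans (α≡2+k i') (sym (α≡2+k i)))))

  g≡ : g T ≡ g T'
  g≡ = trans (g≡1+β i) (trans (cong suc β≡) (sym (g≡1+β i')))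

  n≡ : n T ≡ n T'
  n≡ = Excess-injective (excess i) (subst (Excess (2 ^ k * 12) (n T')) (sym g≡) (excess i'))

corollary1 : (k d : ℕ) → 3 * 2 ^ k + k + 1 ≤ d → d ≤ 6 * 2 ^ k + k + 1 →
    (T T' : Triple) → 𝒯 k T → 𝒯 k T' → δ T ≡ d → δ T' ≡ d → Congruent T T'
corollary1 k d _ _ T T' T∈ T'∈ δT≡d δT'≡d =
  congruent (invariant T∈) (invariant T'∈) (trans δT≡d (sym δT'≡d))
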